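{- Let $a,b,e\in\mathbb Z$ with $a\neq 0$ and $e>0$, and let $h_2(j)=aj^2+bj+e$ for $j\in\mathbb Z_{\geq 0}$, where it is assumed that $h_2(j)\geq 0$ for all $j\geq 0$ (so $h_2\in\mathcal H_0$). If $b<0$ and $b^2>4ae$, then $\operatorname{hdepth}(h_2)\leq 13$.
   Context: $\mathcal H_0$ denotes the set of functions $h:\mathbb Z_{\geq 0}\to\mathbb Z_{\geq 0}$ with $h(0)>0$. For $h\in\mathcal H_0$ and integers $0\leq k\leq d$, set $\beta_k^d(h)=\sum_{j=0}^k(-1)^{k-j}\binom{d-j}{k-j}h(j)$. The Hilbert depth of $h$ is $\operatorname{hdepth}(h)=\max\{d\in\mathbb Z_{\geq 0}\;:\;\beta_k^d(h)\geq 0\text{ for all }0\leq k\leq d\}$. -}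

module Defs where

open import Data.Nat as ℕ using (ℕ; zero; suc; _∸_)
open import Data.Nat.Combinatorics using (_C_)
open import Data.Integer as ℤ using (ℤ; +_; -_; _+_; _*_; _^_; _≤_; -1ℤ; 0ℤ)

InH₀ : (ℕ → ℕ) → Set
InH₀ h = 0 ℕ.< h 0

sumBelow : ℕ → (ℕ → ℤ) → ℤ
sumBelow zero    f = 0ℤ
sumBelow (suc n) f = sumBelow n f + f n

β : (h : ℕ → ℕ) (k d : ℕ) → ℤ
β h k d = sumBelow (suc k) (λ j → (-1ℤ ^ (k ∸ j)) * (+ ((d ∸ j) C (k ∸ j))) * + h j)

-- d belongs to the set whose maximum is hdepth(h)
DepthAdmissible : (ℕ → ℕ) → ℕ → Set
DepthAdmissible h d = ∀ k → k ℕ.≤ d → 0ℤ ≤ β h k d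

HdepthAtMost : (ℕ → ℕ) → ℕ → Set
HdepthAtMost h n = ∀ d → DepthAdmissible h d → d ℕ.≤ n

{-# OPTIONS --safe #-}
-- The numbers β satisfy Pascal's rule β_{k+1}^d = β_{k+1}^{d+1} + β_k^d (k ≤ d), so if every β^{d+1}
-- is nonnegative then so is every β^d: admissible depths are downward closed, and it is
-- enough to show that depth 14 is not admissible. Since β is linear in h, so is
-- 21 β_2^14 + 9 β_11^14, which vanishes on j², is 588 on j and -168 on 1. For
-- h = a j² + b j + e it equals 588 b - 168 e < 0, so β_2^14 or β_11^14 is negative.
module Submission where

open import Defs
open import Data.Nat as ℕ using (ℕ)
open import Data.Integer as ℤ using (ℤ; +_; _+_; _*_; _^_; _<_; 0ℤ)
open import Relation.Binary.PropositionalEquality using (_≡_; _≢_)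

open import Data.Nat using (zero; suc; _∸_; z≤n; _≤′_; ≤′-refl; ≤′-step)
import Data.Nat.Properties as ℕ
open import Data.Nat.Combinatorics using (_C_; nCk+nC[k+1]≡[n+1]C[k+1])
open import Data.Integer using (-_; _-_; -1ℤ; 1ℤ; -[1+_]; +[1+_]; -<+)
import Data.Integer.Properties as ℤ
open import Data.Integer.Tactic.RingSolver using (solve-∀)
open import Relation.Binary.PropositionalEquality using (refl; sym; cong; cong₂; subst; module ≡-Reasoning)
open import Relation.Nullary using (¬_; yes; no; contradiction)

open ≡-Reasoning

sumBelow-cong : ∀ n {f g : ℕ → ℤ} → (∀ j → j ℕ.< n → f j ≡ g j) → sumBelow n f ≡ sumBelow n g
sumBelow-cong zero    f≡g = refl
sumBelow-cong (suc n) f≡g =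
  cong₂ _+_ (sumBelow-cong n (λ j j<n → f≡g j (ℕ.m<n⇒m<1+n j<n))) (f≡g n (ℕ.n<1+n n))

sumBelow-+ : ∀ n (f g : ℕ → ℤ) → sumBelow n (λ j → f j + g j) ≡ sumBelow n f + sumBelow n g
sumBelow-+ zero    f g = refl
sumBelow-+ (suc n) f g = begin
  sumBelow n (λ j → f j + g j) + (f n + g n)   ≡⟨ cong (_+ (f n + g n)) (sumBelow-+ n f g) ⟩
  (sumBelow n f + sumBelow n g) + (f n + g n)  ≡⟨ interchange (sumBelow n f) (sumBelow n g) (f n) (g n) ⟩
  (sumBelow n f + f n) + (sumBelow n g + g n)  ∎
  where
  interchange : ∀ x y u v → (x + y) + (u + v) ≡ (x + u) + (y + v)
  interchange = solve-∀

sumBelow-*ˡ : ∀ n c (f : ℕ → ℤ) → sumBelow n (λ j → c * f j) ≡ c * sumBelow n f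
sumBelow-*ˡ zero    c f = sym (ℤ.*-zeroʳ c)
sumBelow-*ˡ (suc n) c f = begin
  sumBelow n (λ j → c * f j) + c * f n  ≡⟨ cong (_+ c * f n) (sumBelow-*ˡ n c f) ⟩
  c * sumBelow n f + c * f n            ≡⟨ sym (ℤ.*-distribˡ-+ c (sumBelow n f) (f n)) ⟩
  c * (sumBelow n f + f n)              ∎

-- β for ℤ-valued functions: β h is definitionally βᶻ (λ j → + h j).
signedBinomial : ℕ → ℕ → ℕ → ℤ
signedBinomial k d j = (-1ℤ ^ (k ∸ j)) * (+ ((d ∸ j) C (k ∸ j)))

βᶻ-term : (ℕ → ℤ) → ℕ → ℕ → ℕ → ℤ
βᶻ-term g k d j = signedBinomial k d j * g j

βᶻ : (ℕ → ℤ) → ℕ → ℕ → ℤ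
βᶻ g k d = sumBelow (suc k) (βᶻ-term g k d)

βᶻ-cong : ∀ {f g : ℕ → ℤ} → (∀ j → f j ≡ g j) → ∀ k d → βᶻ f k d ≡ βᶻ g k d
βᶻ-cong f≡g k d = sumBelow-cong (suc k) (λ j _ → cong (signedBinomial k d j *_) (f≡g j))

βᶻ-+ : ∀ (f g : ℕ → ℤ) k d → βᶻ (λ j → f j + g j) k d ≡ βᶻ f k d + βᶻ g k d
βᶻ-+ f g k d = begin
  βᶻ (λ j → f j + g j) k d
    ≡⟨ sumBelow-cong (suc k) (λ j _ → ℤ.*-distribˡ-+ (signedBinomial k d j) (f j) (g j)) ⟩
  sumBelow (suc k) (λ j → βᶻ-term f k d j + βᶻ-term g k d j)
    ≡⟨ sumBelow-+ (suc k) (βᶻ-term f k d) (βᶻ-term g k d) ⟩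
  βᶻ f k d + βᶻ g k d
    ∎

βᶻ-*ˡ : ∀ c (g : ℕ → ℤ) k d → βᶻ (λ j → c * g j) k d ≡ c * βᶻ g k d
βᶻ-*ˡ c g k d = begin
  βᶻ (λ j → c * g j) k d
    ≡⟨ sumBelow-cong (suc k) (λ j _ → swap (signedBinomial k d j) c (g j)) ⟩
  sumBelow (suc k) (λ j → c * βᶻ-term g k d j)
    ≡⟨ sumBelow-*ˡ (suc k) c (βᶻ-term g k d) ⟩
  c * βᶻ g k d
    ∎
  where
  swap : ∀ s c x → s * (c * x) ≡ c * (s * x)
  swap = solve-∀

βᶻ-pascal : ∀ g {k d} → k ℕ.≤ d → βᶻ g (suc k) d ≡ βᶻ g (suc k) (suc d) + βᶻ g k d
βᶻ-pascal g {k} {d} k≤d = begin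
  sumBelow (suc k) (t (suc k) d) + t (suc k) d (suc k)
    ≡⟨ cong₂ _+_ (sumBelow-cong (suc k) (λ j j≤k → termwise (ℕ.≤-pred j≤k))) top ⟩
  sumBelow (suc k) (λ j → t (suc k) (suc d) j + t k d j) + t (suc k) (suc d) (suc k)
    ≡⟨ cong (_+ t (suc k) (suc d) (suc k)) (sumBelow-+ (suc k) (t (suc k) (suc d)) (t k d)) ⟩
  (sumBelow (suc k) (t (suc k) (suc d)) + sumBelow (suc k) (t k d)) + t (suc k) (suc d) (suc k)
    ≡⟨ shuffle (sumBelow (suc k) (t (suc k) (suc d))) (sumBelow (suc k) (t k d)) (t (suc k) (suc d) (suc k)) ⟩
  (sumBelow (suc k) (t (suc k) (suc d)) + t (suc k) (suc d) (suc k)) + sumBelow (suc k) (t k d)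
    ∎
  where
  t : ℕ → ℕ → ℕ → ℤ
  t = βᶻ-term g
  shuffle : ∀ x y u → (x + y) + u ≡ (x + u) + y
  shuffle = solve-∀
  pascal : ∀ s X Y H → (-1ℤ * s) * Y * H ≡ (-1ℤ * s) * (X + Y) * H + s * X * H
  pascal = solve-∀
  top : t (suc k) d (suc k) ≡ t (suc k) (suc d) (suc k)
  top rewrite ℕ.n∸n≡0 k = refl
  termwise : ∀ {j} → j ℕ.≤ k → t (suc k) d j ≡ t (suc k) (suc d) j + t k d j
  termwise {j} j≤k
    rewrite ℕ.+-∸-assoc 1 j≤k | ℕ.+-∸-assoc 1 (ℕ.≤-trans j≤k k≤d)
          | sym (nCk+nC[k+1]≡[n+1]C[k+1] (d ∸ j) (k ∸ j))
    = pascal (-1ℤ ^ (k ∸ j)) (+ ((d ∸ j) C (k ∸ j))) (+ ((d ∸ j) C suc (k ∸ j))) (g j)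

module _ (h : ℕ → ℕ) where

  admissible-pred : ∀ {d} → DepthAdmissible h (suc d) → DepthAdmissible h d
  admissible-pred adm zero    _   = adm zero z≤n
  admissible-pred adm (suc k) k<d =
    subst (0ℤ ℤ.≤_) (sym (βᶻ-pascal (λ j → + h j) (ℕ.<⇒≤ k<d)))
      (ℤ.+-mono-≤ (adm (suc k) (ℕ.m≤n⇒m≤1+n k<d)) (admissible-pred adm k (ℕ.<⇒≤ k<d)))

  admissible-≤′ : ∀ {d d′} → d ≤′ d′ → DepthAdmissible h d′ → DepthAdmissible h d
  admissible-≤′ ≤′-refl          adm = adm
  admissible-≤′ (≤′-step d≤′d′) adm = admissible-≤′ d≤′d′ (admissible-pred adm)

  hdepthAtMost : ∀ n → ¬ DepthAdmissible h (suc n) → HdepthAtMost h n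
  hdepthAtMost n ¬adm d adm with d ℕ.≤? n
  ... | yes d≤n = d≤n
  ... | no  d≰n = contradiction (admissible-≤′ (ℕ.≤⇒≤′ (ℕ.≰⇒> d≰n)) adm) ¬adm

quadratic : ℤ → ℤ → ℤ → ℕ → ℤ
quadratic a b e j = a * (+ j) ^ 2 + b * (+ j) + e

βᶻ-quadratic : ∀ a b e k d → βᶻ (quadratic a b e) k d
  ≡ a * βᶻ (λ j → (+ j) ^ 2) k d + b * βᶻ +_ k d + e * βᶻ (λ _ → 1ℤ) k d
βᶻ-quadratic a b e k d = begin
  βᶻ (quadratic a b e) k d
    ≡⟨ βᶻ-+ (λ j → a * (+ j) ^ 2 + b * (+ j)) (λ _ → e) k d ⟩
  βᶻ (λ j → a * (+ j) ^ 2 + b * (+ j)) k d + βᶻ (λ _ → e) k d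
    ≡⟨ cong₂ _+_ (βᶻ-+ (λ j → a * (+ j) ^ 2) (λ j → b * (+ j)) k d)
                 (βᶻ-cong (λ _ → sym (ℤ.*-identityʳ e)) k d) ⟩
  βᶻ (λ j → a * (+ j) ^ 2) k d + βᶻ (λ j → b * (+ j)) k d + βᶻ (λ _ → e * 1ℤ) k d
    ≡⟨ cong₂ _+_ (cong₂ _+_ (βᶻ-*ˡ a (λ j → (+ j) ^ 2) k d) (βᶻ-*ˡ b +_ k d)) (βᶻ-*ˡ e (λ _ → 1ℤ) k d) ⟩
  a * βᶻ (λ j → (+ j) ^ 2) k d + b * βᶻ +_ k d + e * βᶻ (λ _ → 1ℤ) k d
    ∎

certificate : (ℕ → ℤ) → ℤ
certificate g = + 21 * βᶻ g 2 14 + + 9 * βᶻ g 11 14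

certificate-cong : ∀ {f g : ℕ → ℤ} → (∀ j → f j ≡ g j) → certificate f ≡ certificate g
certificate-cong f≡g = cong₂ (λ x y → + 21 * x + + 9 * y) (βᶻ-cong f≡g 2 14) (βᶻ-cong f≡g 11 14)

certificate-quadratic : ∀ a b e → certificate (quadratic a b e) ≡ + 588 * b - + 168 * e
certificate-quadratic a b e = begin
  + 21 * βᶻ (quadratic a b e) 2 14 + + 9 * βᶻ (quadratic a b e) 11 14
    ≡⟨ cong₂ (λ x y → + 21 * x + + 9 * y) (βᶻ-quadratic a b e 2 14) (βᶻ-quadratic a b e 11 14) ⟩
    -- the β-values of j², j and 1 are computed by evaluation
  + 21 * (a * - + 9 + b * - + 11 + e * + 79) + + 9 * (a * + 21 + b * + 91 + e * - + 203)
    ≡⟨ combine a b e ⟩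
  + 588 * b - + 168 * e
    ∎
  where
  combine : ∀ a b e → + 21 * (a * - + 9 + b * - + 11 + e * + 79) + + 9 * (a * + 21 + b * + 91 + e * - + 203)
                      ≡ + 588 * b - + 168 * e
  combine = solve-∀

certificate-nonNeg : ∀ h → DepthAdmissible h 14 → 0ℤ ℤ.≤ certificate (λ j → + h j)
certificate-nonNeg h adm =
  ℤ.+-mono-≤ (ℤ.*-monoˡ-≤-nonNeg (+ 21) (adm 2 (ℕ.m≤m+n 2 12)))
             (ℤ.*-monoˡ-≤-nonNeg (+ 9) (adm 11 (ℕ.m≤m+n 11 3)))

588b-168e<0 : ∀ {b e} → b < 0ℤ → 0ℤ < e → + 588 * b - + 168 * e < 0ℤ
588b-168e<0 { -[1+ _ ]} {+[1+ _ ]} _            _            = -<+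
588b-168e<0 {+ _}                   (ℤ.+<+ ()) _
588b-168e<0 {e = + 0}               _            (ℤ.+<+ ())

theorem2p9 : (a b e : ℤ) → a ≢ 0ℤ → 0ℤ < e → (h : ℕ → ℕ)
    → (∀ j → + h j ≡ a * (+ j) ^ 2 + b * (+ j) + e)
    → b < 0ℤ → (+ 4) * a * e < b ^ 2
    → HdepthAtMost h 13
theorem2p9 a b e _ 0<e h h≡quadratic b<0 _ = hdepthAtMost h 13 λ adm →
  ℤ.<⇒≱ (subst (_< 0ℤ) (sym certificate-h) (588b-168e<0 b<0 0<e)) (certificate-nonNeg h adm)
  where
  certificate-h : certificate (λ j → + h j) ≡ + 588 * b - + 168 * e
  certificate-h = begin
    certificate (λ j → + h j)      ≡⟨ certificate-cong h≡quadratic ⟩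
    certificate (quadratic a b e)  ≡⟨ certificate-quadratic a b e ⟩
    + 588 * b - + 168 * e          ∎
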